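{- Let $G$ be a finite non-abelian group and $m\geqslant2$. Then (1) every fixed point of $\omega$ has the form $(g,g^2,\dots,g^m)$, where $g\in G$ has order dividing $m+1$; in particular, if $\gcd(m+1,|G|)=1$, then $\mathbf{e}=(e,\dots,e)$ is the unique fixed point of $\omega$ and the unique fixed point of $\mathbf{\Delta}_m=\langle\omega,\tau\rangle$; (2) for every $x\in G^\times$ the subgraph $\mathscr{I}_m(x)$ is invariant under the action of $\mathbf{\Delta}_m$.
   Context: For a finite group $G$ with identity $e$, $G^\times=G\setminus\{e\}$. For $y\in G^\times$ and $1\leqslant k<l\leqslant m+1$, $\mathbf{y}_{[k,l)}\in G^m$ has $j$-th coordinate $y$ for $k\leqslant j<l$ and $e$ otherwise; $\mathcal{S}$ is the set of all such $\mathbf{y}_{[k,l)}$, and $\mathscr{G}_m(G)=Cay(G^m,\mathcal{S})$ is the graph on $G^m$ with $\mathbf{g}\sim\mathbf{h}$ iff $\mathbf{h}\mathbf{g}^{ -1}\in\mathcal{S}$. Maps act on the right. $\tau(g_1,\dots,g_m)=(g_m,\dots,g_1)$ and $(g_1,\dots,g_m)^\omega=(g_1^{ -1}g_2,g_1^{ -1}g_3,\dots,g_1^{ -1}g_m,g_1^{ -1})$ are automorphisms of $\mathscr{G}_m(G)$. For $x\in G^\times$, $I_m(x)=\{\mathbf{x}_{[k,l)}\}\cup\{(\mathbf{x}^{ -1})_{[k,l)}\}$ ($1\leqslant k<l\leqslant m+1$) and $\mathscr{I}_m(x)$ is the subgraph of $\mathscr{G}_m(G)$ induced on $I_m(x)$.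 -}

module Defs where

open import Level using (Level; _⊔_)
open import Algebra.Bundles using (Group)
open import Data.Nat using (ℕ; zero; suc; _≤_; _<_; _≤?_; _<?_)
open import Data.Fin using (Fin; toℕ)
open import Data.Vec using (Vec; []; _∷_; map; _∷ʳ_; reverse; tabulate; replicate)
open import Data.Vec.Relation.Binary.Pointwise.Inductive using (Pointwise)
open import Data.Bool using (Bool; true; false; if_then_else_; _∧_)
open import Data.List using (List; []; _∷_)
open import Data.Product using (Σ; _×_; ∃; ∃-syntax)
open import Relation.Nullary using (¬_)
open import Relation.Nullary.Decidable using (⌊_⌋)
open import Relation.Binary.PropositionalEquality using (_≡_)

module _ {c ℓ : Level} (G : Group c ℓ) where
  open Group G

  _≋_ : {m : ℕ} → Vec Carrier m → Vec Carrier m → Set (c ⊔ ℓ)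
  u ≋ v = Pointwise _≈_ u v

  record FiniteOrder (n : ℕ) : Set (c ⊔ ℓ) where
    field
      enum  : Fin n → Carrier
      surj  : ∀ a → ∃[ i ] (enum i ≈ a)
      inj   : ∀ i j → enum i ≈ enum j → i ≡ j

  NonAbelian : Set (c ⊔ ℓ)
  NonAbelian = ¬ (∀ a b → a ∙ b ≈ b ∙ a)

  pow : Carrier → ℕ → Carrier
  pow g zero    = ε
  pow g (suc k) = g ∙ pow g k

  powers : Carrier → (m : ℕ) → Vec Carrier m
  powers g m = tabulate (λ i → pow g (suc (toℕ i)))

  𝐞 : (m : ℕ) → Vec Carrier m
  𝐞 m = replicate m ε

  ω : {n : ℕ} → Vec Carrier (suc n) → Vec Carrier (suc n)
  ω (g ∷ gs) = map (λ h → g ⁻¹ ∙ h) gs ∷ʳ (g ⁻¹)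

  τ : {m : ℕ} → Vec Carrier m → Vec Carrier m
  τ = reverse

  -- elements of Δ_m = ⟨ω, τ⟩ as words: true = ω, false = τ.
  -- (Δ_m is finite, so the generated group equals the generated monoid.)
  act : {n : ℕ} → List Bool → Vec Carrier (suc n) → Vec Carrier (suc n)
  act []          v = v
  act (true  ∷ w) v = act w (ω v)
  act (false ∷ w) v = act w (τ v)

  -- y_[k,l) ∈ G^m : j-th coordinate (1-based) is y if k ≤ j < l, else e
  seg : {m : ℕ} → Carrier → ℕ → ℕ → Vec Carrier m
  seg y k l = tabulate (λ i → if ⌊ k ≤? suc (toℕ i) ⌋ ∧ ⌊ suc (toℕ i) <? l ⌋ then y else ε)

  InI : {m : ℕ} → Carrier → Vec Carrier m → Set (c ⊔ ℓ)
  InI {m} x v = Σ ℕ λ k → Σ ℕ λ l → (1 ≤ k) × (k < l) × (l ≤ suc m) ×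
                  ((v ≋ seg x k l) Data.Sum.⊎ (v ≋ seg (x ⁻¹) k l))
    where import Data.Sum

-- A fixed point (g₁, …, gₘ) of ω satisfies g₁⁻¹ gⱼ₊₁ ≈ gⱼ and g₁⁻¹ ≈ gₘ, so gⱼ ≈ g₁ʲ and
-- g₁ᵐ⁺¹ ≈ e.  The order of g₁ divides m + 1 and, since the orbits of left multiplication by
-- g₁ partition G into classes of that size, also |G|; when gcd (m + 1) |G| = 1 it is 1.
-- For (2), the elements of I_m(x) are exactly the blocks e^p z^(q+1) e^r with z ∈ {x, x⁻¹}.
-- τ turns such a block into e^r z^(q+1) e^p, and ω moves a leading e to the end when p > 0
-- and turns z^(q+1) e^r into e^q (z⁻¹)^(r+1) when p = 0.
module Submission where

open import Defs hiding (_≋_)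
open import Level using (Level; _⊔_)
open import Algebra.Bundles using (Group)
import Algebra.Properties.Group as GroupProperties
import Algebra.Properties.Loop as LoopProperties
import Data.Nat as ℕ
open import Data.Nat using (ℕ; zero; suc; _+_; _*_; _∸_; _≤_; _<_; _≤?_; _<?_; z≤n; s≤s; NonZero; >-nonZero)
open import Data.Nat.Properties using (+-comm; +-suc; +-assoc; m<m+n; m≤n⇒∃[o]m+o≡n; <⇒≱; m≤m+n; +-monoʳ-≤; +-monoʳ-<; ≤-refl; m∸n+n≡m; n<1+n; m<n⇒m<1+n; m<1+n⇒m<n∨m≡n; m<n⇒0<n∸m; m∸n≤m; m+[n∸m]≡n; ≤-<-trans; <⇒≤; anyUpTo?)
open import Data.Nat.DivMod using (_%_; _/_; m≡m%n+[m/n]*n; m%n<n)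
open import Data.Nat.Divisibility using (_∣_; m%n≡0⇒n∣m; _∣0; ∣-reflexive; ∣m∣n⇒∣m+n; ∣1⇒≡1)
open import Data.Nat.GCD using (gcd; gcd-greatest)
open import Data.Nat.Induction using (<-rec)
open import Data.Fin using (Fin; zero; suc; toℕ)
import Data.Fin.Properties as Fin
open import Data.Fin.Properties using (0≢1+n; toℕ<n)
open import Data.Bool using (Bool; true; false; if_then_else_; _∧_)
open import Data.Empty using (⊥-elim)
open import Data.List using (List; []; _∷_)
import Data.List as List
open import Data.List.Relation.Unary.Any as Any using (Any; here; there; any?)
import Data.List.Relation.Unary.Any.Properties as Any
open import Data.Product using (_×_; _,_; ∃; ∃-syntax; proj₁; proj₂)
open import Data.Sum as Sum using (_⊎_; inj₁; inj₂; [_,_]′)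
open import Data.Vec using (Vec; []; _∷_; _++_; _∷ʳ_; map; replicate; reverse; tabulate; cast)
open import Data.Vec.Properties using (reverse-∷; map-reverse; map-const; map-replicate; map-++; ++-∷ʳ-eqFree; reverse-++-eqFree)
open import Data.Vec.Relation.Binary.Pointwise.Inductive as Pointwise using ([]; _∷_)
open import Function using (_∘_; id; const)
open import Relation.Binary using (Setoid; Decidable)
open import Relation.Binary.PropositionalEquality as ≡ using (_≡_)
import Relation.Binary.Reasoning.Setoid as SetoidReasoning
open import Relation.Nullary using (¬_; yes; no; does; _×-dec_)
open import Relation.Nullary.Decidable using (⌊_⌋)
open import Relation.Unary using (Pred; _⊆_) renaming (Decidable to Decidable₁)
open import Relation.Unary.Properties using (_∪?_)

module VecProperties {a} {A : Set a} where

  replicate-∷ʳ : ∀ n (x : A) → replicate n x ∷ʳ x ≡ replicate (suc n) x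
  replicate-∷ʳ zero    x = ≡.refl
  replicate-∷ʳ (suc n) x = ≡.cong (x ∷_) (replicate-∷ʳ n x)

  reverse-replicate : ∀ n (x : A) → reverse (replicate n x) ≡ replicate n x
  reverse-replicate n x = begin
    reverse (replicate n x)                  ≡⟨ ≡.cong reverse (map-const (replicate n x) x) ⟨
    reverse (map (const x) (replicate n x))  ≡⟨ map-reverse (const x) (replicate n x) ⟨
    map (const x) (reverse (replicate n x))  ≡⟨ map-const (reverse (replicate n x)) x ⟩
    replicate n x                            ∎
    where open ≡.≡-Reasoning

  tabulate-++ : ∀ p q (h : ℕ → A) →
    tabulate {n = p + q} (h ∘ toℕ) ≡ tabulate {n = p} (h ∘ toℕ) ++ tabulate {n = q} (λ i → h (p + toℕ i))
  tabulate-++ zero    q h = ≡.refl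
  tabulate-++ (suc p) q h = ≡.cong (h 0 ∷_) (tabulate-++ p q (h ∘ suc))

module VecEquality {a ℓ} (S : Setoid a ℓ) where
  open Setoid S renaming (Carrier to A)
  open import Data.Vec.Relation.Binary.Equality.Setoid S public
    using (_≋_; ≋-refl; ≋-sym; ≋-trans; ++⁺; ++-assoc; ++-identityʳ)

  private
    variable
      m n : ℕ

  ≋-reflexive : {xs ys : Vec A n} → xs ≡ ys → xs ≋ ys
  ≋-reflexive ≡.refl = ≋-refl

  module ≋-Reasoning where
    infix  1 begin_
    infixr 2 _≋⟨_⟩_ _≡⟨_⟩_
    infix  3 _∎

    begin_ : {xs : Vec A m} {ys : Vec A n} → xs ≋ ys → xs ≋ ys
    begin xs≋ys = xs≋ys

    _≋⟨_⟩_ : ∀ {o} (xs : Vec A m) {ys : Vec A n} {zs : Vec A o} → xs ≋ ys → ys ≋ zs → xs ≋ zs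
    xs ≋⟨ xs≋ys ⟩ ys≋zs = ≋-trans xs≋ys ys≋zs

    _≡⟨_⟩_ : (xs : Vec A m) {ys : Vec A m} {zs : Vec A n} → xs ≡ ys → ys ≋ zs → xs ≋ zs
    xs ≡⟨ ≡.refl ⟩ xs≋zs = xs≋zs

    _∎ : (xs : Vec A m) → xs ≋ xs
    xs ∎ = ≋-refl

  cast-≋ : .(eq : m ≡ n) (xs : Vec A m) → cast eq xs ≋ xs
  cast-≋ {n = zero}  eq []       = []
  cast-≋ {n = suc n} eq (x ∷ xs) = refl ∷ cast-≋ (≡.cong ℕ.pred eq) xs

  replicate⁺ : ∀ n {x y} → x ≈ y → replicate n x ≋ replicate n y
  replicate⁺ zero    x≈y = []
  replicate⁺ (suc n) x≈y = x≈y ∷ replicate⁺ n x≈y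

  tabulate-const : ∀ {f : Fin n → A} {x} → (∀ i → f i ≈ x) → tabulate f ≋ replicate n x
  tabulate-const {n = zero}  f≈x = []
  tabulate-const {n = suc n} f≈x = f≈x zero ∷ tabulate-const (f≈x ∘ suc)

  map-id≈ : ∀ {f : A → A} → (∀ x → f x ≈ x) → (xs : Vec A n) → map f xs ≋ xs
  map-id≈ f≈id []       = []
  map-id≈ f≈id (x ∷ xs) = f≈id x ∷ map-id≈ f≈id xs

  ∷ʳ⁺ : {xs : Vec A m} {ys : Vec A n} {x y : A} → xs ≋ ys → x ≈ y → xs ∷ʳ x ≋ ys ∷ʳ y
  ∷ʳ⁺ []              x≈y = x≈y ∷ []
  ∷ʳ⁺ (x≈y₀ ∷ xs≋ys) x≈y = x≈y₀ ∷ ∷ʳ⁺ xs≋ys x≈y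

  reverse⁺ : {xs : Vec A m} {ys : Vec A n} → xs ≋ ys → reverse xs ≋ reverse ys
  reverse⁺ []                                         = []
  reverse⁺ {xs = x ∷ xs} {ys = y ∷ ys} (x≈y ∷ xs≋ys) = begin
    reverse (x ∷ xs)  ≡⟨ reverse-∷ x xs ⟩
    reverse xs ∷ʳ x   ≋⟨ ∷ʳ⁺ (reverse⁺ xs≋ys) x≈y ⟩
    reverse ys ∷ʳ y   ≡⟨ ≡.sym (reverse-∷ y ys) ⟩
    reverse (y ∷ ys)  ∎
    where open ≋-Reasoning

  ++-∷ʳ : ∀ (xs : Vec A m) (ys : Vec A n) z → (xs ++ ys) ∷ʳ z ≋ xs ++ (ys ∷ʳ z)
  ++-∷ʳ xs ys z = ≋-trans (≋-sym (cast-≋ _ ((xs ++ ys) ∷ʳ z))) (≋-reflexive (++-∷ʳ-eqFree z xs ys))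

  reverse-++ : ∀ (xs : Vec A m) (ys : Vec A n) → reverse (xs ++ ys) ≋ reverse ys ++ reverse xs
  reverse-++ xs ys = ≋-trans (≋-sym (cast-≋ _ (reverse (xs ++ ys)))) (≋-reflexive (reverse-++-eqFree xs ys))

module Counting where

  private
    variable
      p q : Level
      n : ℕ

  count : {P : Pred (Fin n) p} → Decidable₁ P → ℕ
  count {zero}  P? = 0
  count {suc n} P? = (if does (P? zero) then suc else id) (count (P? ∘ suc))

  count-cong : {P : Pred (Fin n) p} {Q : Pred (Fin n) q} (P? : Decidable₁ P) (Q? : Decidable₁ Q) →
               P ⊆ Q → Q ⊆ P → count P? ≡ count Q?
  count-cong {n = zero}  P? Q? P⊆Q Q⊆P = ≡.refl
  count-cong {n = suc n} P? Q? P⊆Q Q⊆P with P? zero | Q? zero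
  ... | yes _  | yes _  = ≡.cong suc (count-cong (P? ∘ suc) (Q? ∘ suc) P⊆Q Q⊆P)
  ... | no _   | no _   = count-cong (P? ∘ suc) (Q? ∘ suc) P⊆Q Q⊆P
  ... | yes P₀ | no ¬Q₀ = ⊥-elim (¬Q₀ (P⊆Q P₀))
  ... | no ¬P₀ | yes Q₀ = ⊥-elim (¬P₀ (Q⊆P Q₀))

  count-none : {P : Pred (Fin n) p} (P? : Decidable₁ P) → (∀ i → ¬ P i) → count P? ≡ 0
  count-none {n = zero}  P? none = ≡.refl
  count-none {n = suc n} P? none with P? zero
  ... | yes P₀ = ⊥-elim (none zero P₀)
  ... | no _   = count-none (P? ∘ suc) (none ∘ suc)

  count-all : {P : Pred (Fin n) p} (P? : Decidable₁ P) → (∀ i → P i) → count P? ≡ n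
  count-all {n = zero}  P? all = ≡.refl
  count-all {n = suc n} P? all with P? zero
  ... | yes _  = ≡.cong suc (count-all (P? ∘ suc) (all ∘ suc))
  ... | no ¬P₀ = ⊥-elim (¬P₀ (all zero))

  count-∪ : {P : Pred (Fin n) p} {Q : Pred (Fin n) q} (P? : Decidable₁ P) (Q? : Decidable₁ Q) →
            (∀ {i} → P i → ¬ Q i) → count (P? ∪? Q?) ≡ count P? + count Q?
  count-∪ {n = zero}  P? Q? disjoint = ≡.refl
  count-∪ {n = suc n} P? Q? disjoint with P? zero | Q? zero
  ... | yes P₀ | yes Q₀ = ⊥-elim (disjoint P₀ Q₀)
  ... | yes _  | no _   = ≡.cong suc (count-∪ (P? ∘ suc) (Q? ∘ suc) disjoint)
  ... | no _   | yes _  = ≡.trans (≡.cong suc (count-∪ (P? ∘ suc) (Q? ∘ suc) disjoint)) (≡.sym (+-suc _ _))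
  ... | no _   | no _   = count-∪ (P? ∘ suc) (Q? ∘ suc) disjoint

  count-unique : {P : Pred (Fin n) p} (P? : Decidable₁ P) (i₀ : Fin n) →
                 P i₀ → (∀ {i} → P i → i ≡ i₀) → count P? ≡ 1
  count-unique P? zero Pi₀ unique with P? zero
  ... | yes _  = ≡.cong suc (count-none (P? ∘ suc) λ i Pi → 0≢1+n (≡.sym (unique Pi)))
  ... | no ¬P₀ = ⊥-elim (¬P₀ Pi₀)
  count-unique P? (suc i₀) Pi₀ unique with P? zero
  ... | yes P₀ = ⊥-elim (0≢1+n (unique P₀))
  ... | no _   = count-unique (P? ∘ suc) i₀ Pi₀ (Fin.suc-injective ∘ unique)

module Powers {c ℓ} (G : Group c ℓ) where
  open Group G
  open import Relation.Binary.Reasoning.Setoid setoid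

  pow-+ : ∀ g m n → pow G g (m + n) ≈ pow G g m ∙ pow G g n
  pow-+ g zero    n = sym (identityˡ _)
  pow-+ g (suc m) n = trans (∙-congˡ (pow-+ g m n)) (sym (assoc _ _ _))

  pow-sucʳ : ∀ g n → pow G g (suc n) ≈ pow G g n ∙ g
  pow-sucʳ g n = begin
    pow G g (suc n)      ≡⟨ ≡.cong (pow G g) (+-comm 1 n) ⟩
    pow G g (n + 1)      ≈⟨ pow-+ g n 1 ⟩
    pow G g n ∙ (g ∙ ε)  ≈⟨ ∙-congˡ (identityʳ g) ⟩
    pow G g n ∙ g        ∎

  pow-*-ε : ∀ {g d} → pow G g d ≈ ε → ∀ q → pow G g (q * d) ≈ ε
  pow-*-ε g^d≈ε zero              = refl
  pow-*-ε {g} {d} g^d≈ε (suc q) = begin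
    pow G g (d + q * d)          ≈⟨ pow-+ g d (q * d) ⟩
    pow G g d ∙ pow G g (q * d)  ≈⟨ ∙-cong g^d≈ε (pow-*-ε g^d≈ε q) ⟩
    ε ∙ ε                        ≈⟨ identityˡ ε ⟩
    ε                            ∎

  pow-≈ε : ∀ {g} → g ≈ ε → ∀ n → pow G g n ≈ ε
  pow-≈ε g≈ε zero    = refl
  pow-≈ε g≈ε (suc n) = trans (∙-cong g≈ε (pow-≈ε g≈ε n)) (identityˡ ε)

module Action {c ℓ} (G : Group c ℓ) where
  open Group G
  open GroupProperties G using (\\-leftDividesˡ; ε⁻¹≈ε; loop)
  open LoopProperties loop using (ε\\x≈x)
  open Powers G
  open VecProperties
  open VecEquality setoid
  open import Relation.Binary.Reasoning.Setoid setoid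

  ω-cong : ∀ {m n} {u : Vec Carrier (suc m)} {v : Vec Carrier (suc n)} → u ≋ v → ω G u ≋ ω G v
  ω-cong {u = g ∷ gs} {h ∷ hs} (g≈h ∷ gs≋hs) =
    ∷ʳ⁺ (Pointwise.map⁺ (∙-cong (⁻¹-cong g≈h)) gs≋hs) (⁻¹-cong g≈h)

  act-cong : ∀ {n} w {u v : Vec Carrier (suc n)} → u ≋ v → act G w u ≋ act G w v
  act-cong []          u≋v = u≋v
  act-cong (true ∷ w)  u≋v = act-cong w (ω-cong u≋v)
  act-cong (false ∷ w) u≋v = act-cong w (reverse⁺ u≋v)

  ω∧τ-fixed⇒act-fixed : ∀ {n} {v : Vec Carrier (suc n)} → ω G v ≋ v → τ G v ≋ v → ∀ w → act G w v ≋ v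
  ω∧τ-fixed⇒act-fixed ω-fixed τ-fixed []          = ≋-refl
  ω∧τ-fixed⇒act-fixed ω-fixed τ-fixed (true ∷ w)  =
    ≋-trans (act-cong w ω-fixed) (ω∧τ-fixed⇒act-fixed ω-fixed τ-fixed w)
  ω∧τ-fixed⇒act-fixed ω-fixed τ-fixed (false ∷ w) =
    ≋-trans (act-cong w τ-fixed) (ω∧τ-fixed⇒act-fixed ω-fixed τ-fixed w)

  ω-𝐞 : ∀ n → ω G (𝐞 G (suc n)) ≋ 𝐞 G (suc n)
  ω-𝐞 n = ≋-trans (∷ʳ⁺ (map-id≈ ε\\x≈x (replicate n ε)) ε⁻¹≈ε) (≋-reflexive (replicate-∷ʳ n ε))

  τ-𝐞 : ∀ n → τ G (𝐞 G n) ≋ 𝐞 G n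
  τ-𝐞 n = ≋-reflexive (reverse-replicate n ε)

  shift-fixed⇒geometric : ∀ {n} g a b (hs : Vec Carrier n) →
    map (g ⁻¹ ∙_) hs ∷ʳ a ≋ b ∷ hs →
    hs ≋ tabulate {n = n} (λ i → pow G g (suc (toℕ i)) ∙ b) × a ≈ pow G g n ∙ b
  shift-fixed⇒geometric g a b []       (a≈b ∷ []) = [] , trans a≈b (sym (identityˡ b))
  shift-fixed⇒geometric {suc n} g a b (h ∷ hs) (g⁻¹h≈b ∷ rest)
    with shift-fixed⇒geometric g a h hs rest
  ... | hs≋ , a≈ =
    trans (sym (identityˡ h)) (shift 0) ∷ ≋-trans hs≋ (Pointwise.tabulate⁺ (shift ∘ suc ∘ toℕ)) ,
    trans a≈ (shift n)
    where
    shift : ∀ k → pow G g k ∙ h ≈ pow G g (suc k) ∙ b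
    shift k = begin
      pow G g k ∙ h        ≈⟨ ∙-congˡ (trans (sym (\\-leftDividesˡ g h)) (∙-congˡ g⁻¹h≈b)) ⟩
      pow G g k ∙ (g ∙ b)  ≈⟨ sym (assoc _ _ _) ⟩
      pow G g k ∙ g ∙ b    ≈⟨ ∙-congʳ (sym (pow-sucʳ g k)) ⟩
      pow G g (suc k) ∙ b  ∎

  ω-fixed⇒powers : ∀ {n} (v : Vec Carrier (suc n)) → ω G v ≋ v →
    ∃[ g ] (pow G g (suc (suc n)) ≈ ε × v ≋ powers G g (suc n))
  ω-fixed⇒powers {n} (g ∷ gs) fixed with shift-fixed⇒geometric g (g ⁻¹) g gs fixed
  ... | gs≋ , g⁻¹≈ =
    g , g^[2+n]≈ε , sym (identityʳ g) ∷ ≋-trans gs≋ (Pointwise.tabulate⁺ λ i → sym (pow-sucʳ g (suc (toℕ i))))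
    where
    g^[2+n]≈ε : pow G g (suc (suc n)) ≈ ε
    g^[2+n]≈ε = begin
      g ∙ pow G g (suc n)  ≈⟨ ∙-congˡ (pow-sucʳ g n) ⟩
      g ∙ (pow G g n ∙ g)  ≈⟨ ∙-congˡ g⁻¹≈ ⟨
      g ∙ g ⁻¹             ≈⟨ inverseʳ g ⟩
      ε                    ∎

module Order {c ℓ} (G : Group c ℓ) (_≈?_ : Decidable (Group._≈_ G)) where
  open Group G
  open GroupProperties G using (∙-cancelˡ)
  open Powers G
  open import Relation.Binary.Reasoning.Setoid setoid

  record IsOrderOf (g : Carrier) (d : ℕ) : Set ℓ where
    field
      ⦃ nonZero ⦄ : NonZero d
      pow-order≈ε : pow G g d ≈ ε
      minimal     : ∀ {j} → 0 < j → j < d → ¬ pow G g j ≈ ε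

  order-exists : ∀ {g} j → 0 < j → pow G g j ≈ ε → ∃ (IsOrderOf g)
  order-exists {g} = <-rec _ shrink
    where
    shrink : ∀ j → (∀ {t} → t < j → 0 < t → pow G g t ≈ ε → ∃ (IsOrderOf g)) →
             0 < j → pow G g j ≈ ε → ∃ (IsOrderOf g)
    shrink j smaller 0<j g^j≈ε with anyUpTo? (λ t → (0 <? t) ×-dec (pow G g t ≈? ε)) j
    ... | yes (t , t<j , 0<t , g^t≈ε) = smaller t<j 0<t g^t≈ε
    ... | no none = j , record
      { nonZero     = >-nonZero 0<j
      ; pow-order≈ε = g^j≈ε
      ; minimal     = λ 0<t t<j g^t≈ε → none (_ , t<j , 0<t , g^t≈ε)
      }

  module _ {g d} (order : IsOrderOf g d) where
    open IsOrderOf order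

    pow-mod : ∀ t → pow G g t ≈ pow G g (t % d)
    pow-mod t = begin
      pow G g t                              ≡⟨ ≡.cong (pow G g) (m≡m%n+[m/n]*n t d) ⟩
      pow G g (t % d + t / d * d)            ≈⟨ pow-+ g (t % d) (t / d * d) ⟩
      pow G g (t % d) ∙ pow G g (t / d * d)  ≈⟨ ∙-congˡ (pow-*-ε pow-order≈ε (t / d)) ⟩
      pow G g (t % d) ∙ ε                    ≈⟨ identityʳ _ ⟩
      pow G g (t % d)                        ∎

    order∣ : ∀ {n} → pow G g n ≈ ε → d ∣ n
    order∣ {n} g^n≈ε with n % d in n%d≡r
    ... | zero  = m%n≡0⇒n∣m n d n%d≡r
    ... | suc r = ⊥-elim (minimal (s≤s z≤n) (≡.subst (_< d) n%d≡r (m%n<n n d)) g^[1+r]≈ε)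
      where
      g^[1+r]≈ε : pow G g (suc r) ≈ ε
      g^[1+r]≈ε = trans (≡.subst (λ t → pow G g t ≈ pow G g n) n%d≡r (sym (pow-mod n))) g^n≈ε

    pow-injective : ∀ {i j} → i < j → j < d → ¬ pow G g i ≈ pow G g j
    pow-injective {i} {j} i<j j<d g^i≈g^j =
      minimal (m<n⇒0<n∸m i<j) (≤-<-trans (m∸n≤m j i) j<d) (∙-cancelˡ (pow G g i) _ _ (begin
        pow G g i ∙ pow G g (j ∸ i)  ≈⟨ pow-+ g i (j ∸ i) ⟨
        pow G g (i + (j ∸ i))        ≡⟨ ≡.cong (pow G g) (m+[n∸m]≡n (<⇒≤ i<j)) ⟩
        pow G g j                    ≈⟨ g^i≈g^j ⟨
        pow G g i                    ≈⟨ identityʳ _ ⟨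
        pow G g i ∙ ε                ∎))

module FiniteGroup {c ℓ} (G : Group c ℓ) {N} (finite : FiniteOrder G N) where
  open Group G
  open GroupProperties G using (∙-cancelʳ)
  open FiniteOrder finite
  open Powers G
  open Action G using (ω-fixed⇒powers)
  open VecEquality setoid using (_≋_; ≋-trans; tabulate-const)
  open Counting

  infix 4 _≈?_
  _≈?_ : Decidable _≈_
  x ≈? y with surj x | surj y
  ... | i , eᵢ≈x | j , eⱼ≈y with i Fin.≟ j
  ... | yes ≡.refl = yes (trans (sym eᵢ≈x) eⱼ≈y)
  ... | no i≢j     = no λ x≈y → i≢j (inj i j (trans eᵢ≈x (trans x≈y (sym eⱼ≈y))))

  open Order G _≈?_ public

  #_ : ∀ {p} {P : Pred Carrier p} → Decidable₁ P → ℕ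
  # P? = count (P? ∘ enum)

  #-≈ : ∀ a → # (a ≈?_) ≡ 1
  #-≈ a = count-unique _ i₀ (sym eᵢ₀≈a) λ {i} a≈eᵢ → inj i i₀ (trans (sym a≈eᵢ) (sym eᵢ₀≈a))
    where
    i₀ = proj₁ (surj a)
    eᵢ₀≈a = proj₂ (surj a)

  module _ {g d} (order : IsOrderOf g d) where
    open IsOrderOf order

    Reaches : ℕ → Carrier → Pred Carrier ℓ
    Reaches k y x = ∃[ j ] (j < k × pow G g j ∙ y ≈ x)

    reaches? : ∀ k y → Decidable₁ (Reaches k y)
    reaches? k y x = anyUpTo? (λ j → pow G g j ∙ y ≈? x) k

    Orbit : Carrier → Pred Carrier ℓ
    Orbit = Reaches d

    orbit : ∀ {y x} t → pow G g t ∙ y ≈ x → Orbit y x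
    orbit t g^t∙y≈x = t % d , m%n<n t d , trans (∙-congʳ (sym (pow-mod order t))) g^t∙y≈x

    orbit-refl : ∀ x → Orbit x x
    orbit-refl x = orbit 0 (identityˡ x)

    orbit-trans : ∀ {y z x} → Orbit y z → Orbit z x → Orbit y x
    orbit-trans {y} {z} {x} (i , _ , g^i∙y≈z) (j , _ , g^j∙z≈x) = orbit (j + i) (begin
      pow G g (j + i) ∙ y          ≈⟨ ∙-congʳ (pow-+ g j i) ⟩
      pow G g j ∙ pow G g i ∙ y    ≈⟨ assoc _ _ _ ⟩
      pow G g j ∙ (pow G g i ∙ y)  ≈⟨ ∙-congˡ g^i∙y≈z ⟩
      pow G g j ∙ z                ≈⟨ g^j∙z≈x ⟩
      x                            ∎)
      where open SetoidReasoning setoid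

    orbit-sym : ∀ {y x} → Orbit y x → Orbit x y
    orbit-sym {y} {x} (j , j<d , g^j∙y≈x) = orbit (d ∸ j) (begin
      pow G g (d ∸ j) ∙ x                ≈⟨ ∙-congˡ g^j∙y≈x ⟨
      pow G g (d ∸ j) ∙ (pow G g j ∙ y)  ≈⟨ assoc _ _ _ ⟨
      pow G g (d ∸ j) ∙ pow G g j ∙ y    ≈⟨ ∙-congʳ (pow-+ g (d ∸ j) j) ⟨
      pow G g (d ∸ j + j) ∙ y            ≡⟨ ≡.cong (λ t → pow G g t ∙ y) (m∸n+n≡m (<⇒≤ j<d)) ⟩
      pow G g d ∙ y                      ≈⟨ ∙-congʳ pow-order≈ε ⟩
      ε ∙ y                              ≈⟨ identityˡ y ⟩
      y                                  ∎)
      where open SetoidReasoning setoid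

    #-reaches : ∀ k y → k ≤ d → # reaches? k y ≡ k
    #-reaches zero    y _   = count-none (reaches? 0 y ∘ enum) λ { i (_ , () , _) }
    #-reaches (suc k) y k<d = begin
      # reaches? (suc k) y         ≡⟨ count-cong _ ((earlier ∪? last) ∘ enum) split join ⟩
      # (earlier ∪? last)          ≡⟨ count-∪ (earlier ∘ enum) (last ∘ enum) disjoint ⟩
      # earlier + # last           ≡⟨ ≡.cong₂ _+_ (#-reaches k y (<⇒≤ k<d)) (#-≈ _) ⟩
      k + 1                        ≡⟨ +-comm k 1 ⟩
      suc k                        ∎
      where
      open ≡.≡-Reasoning
      earlier : Decidable₁ (Reaches k y)
      earlier = reaches? k y
      last : Decidable₁ (pow G g k ∙ y ≈_)
      last = pow G g k ∙ y ≈?_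
      split : ∀ {x} → Reaches (suc k) y x → Reaches k y x ⊎ pow G g k ∙ y ≈ x
      split (j , j<1+k , g^j∙y≈x) with m<1+n⇒m<n∨m≡n j<1+k
      ... | inj₁ j<k    = inj₁ (j , j<k , g^j∙y≈x)
      ... | inj₂ ≡.refl = inj₂ g^j∙y≈x
      join : ∀ {x} → Reaches k y x ⊎ pow G g k ∙ y ≈ x → Reaches (suc k) y x
      join (inj₁ (j , j<k , g^j∙y≈x)) = j , m<n⇒m<1+n j<k , g^j∙y≈x
      join (inj₂ g^k∙y≈x)            = k , n<1+n k , g^k∙y≈x
      disjoint : ∀ {x} → Reaches k y x → ¬ pow G g k ∙ y ≈ x
      disjoint (j , j<k , g^j∙y≈x) g^k∙y≈x =
        pow-injective order j<k k<d (∙-cancelʳ y _ _ (trans g^j∙y≈x (sym g^k∙y≈x)))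

    OrbitOfSome : List Carrier → Pred Carrier (c ⊔ ℓ)
    OrbitOfSome ys x = Any (λ y → Orbit y x) ys

    orbitOfSome? : ∀ ys → Decidable₁ (OrbitOfSome ys)
    orbitOfSome? ys x = any? (λ y → reaches? d y x) ys

    order∣#orbits : ∀ ys → d ∣ # orbitOfSome? ys
    order∣#orbits [] = ≡.subst (d ∣_) (≡.sym (count-none (orbitOfSome? [] ∘ enum) λ _ ())) (d ∣0)
    order∣#orbits (y ∷ ys) with orbitOfSome? ys y
    ... | yes y-covered =
      ≡.subst (d ∣_) (count-cong (orbitOfSome? ys ∘ enum) (orbitOfSome? (y ∷ ys) ∘ enum) there absorb)
        (order∣#orbits ys)
      where
      absorb : ∀ {x} → OrbitOfSome (y ∷ ys) x → OrbitOfSome ys x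
      absorb (here y~x)   = Any.map (λ z~y → orbit-trans z~y y~x) y-covered
      absorb (there some) = some
    ... | no y-new =
      ≡.subst (d ∣_) (≡.sym #-split)
        (∣m∣n⇒∣m+n (∣-reflexive (≡.sym (#-reaches d y ≤-refl))) (order∣#orbits ys))
      where
      disjoint : ∀ {x} → Orbit y x → ¬ OrbitOfSome ys x
      disjoint y~x some = y-new (Any.map (λ z~x → orbit-trans z~x (orbit-sym y~x)) some)
      #-split : # orbitOfSome? (y ∷ ys) ≡ # reaches? d y + # orbitOfSome? ys
      #-split = ≡.trans
        (count-cong (orbitOfSome? (y ∷ ys) ∘ enum) ((reaches? d y ∪? orbitOfSome? ys) ∘ enum)
                    Any.toSum Any.fromSum)
        (count-∪ (reaches? d y ∘ enum) (orbitOfSome? ys ∘ enum) disjoint)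

    order∣card : d ∣ N
    order∣card = ≡.subst (d ∣_) (count-all (orbitOfSome? everything ∘ enum) covered) (order∣#orbits everything)
      where
      everything : List Carrier
      everything = List.tabulate enum
      covered : ∀ i → OrbitOfSome everything (enum i)
      covered i = Any.tabulate⁺ i (orbit-refl (enum i))

  pow≈ε∧coprime⇒≈ε : ∀ {g n} → pow G g (suc n) ≈ ε → gcd (suc n) N ≡ 1 → g ≈ ε
  pow≈ε∧coprime⇒≈ε {g} {n} g^[1+n]≈ε coprime with order-exists (suc n) (s≤s z≤n) g^[1+n]≈ε
  ... | d , order = trans (sym (identityʳ g)) (≡.subst (λ t → pow G g t ≈ ε) d≡1 (IsOrderOf.pow-order≈ε order))
    where
    d≡1 : d ≡ 1
    d≡1 = ∣1⇒≡1 (≡.subst (d ∣_) coprime (gcd-greatest (order∣ order {suc n} g^[1+n]≈ε) (order∣card order)))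

  ω-fixed∧coprime⇒𝐞 : ∀ {n} → gcd (suc (suc n)) N ≡ 1 →
                      (v : Vec Carrier (suc n)) → ω G v ≋ v → v ≋ 𝐞 G (suc n)
  ω-fixed∧coprime⇒𝐞 coprime v fixed with ω-fixed⇒powers v fixed
  ... | g , g^[2+n]≈ε , v≋powers =
    ≋-trans v≋powers (tabulate-const λ i → pow-≈ε (pow≈ε∧coprime⇒≈ε g^[2+n]≈ε coprime) (suc (toℕ i)))

module Segments {c ℓ} (G : Group c ℓ) where
  open Group G
  open GroupProperties G using (ε⁻¹≈ε; ⁻¹-involutive; loop)
  open LoopProperties loop using (ε\\x≈x)
  open VecProperties
  open VecEquality setoid
  open Action G using (ω-cong)

  block : Carrier → (p q r : ℕ) → Vec Carrier (p + (suc q + r))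
  block z p q r = replicate p ε ++ replicate (suc q) z ++ replicate r ε

  block-cong : ∀ {z z′} p q r → z ≈ z′ → block z p q r ≋ block z′ p q r
  block-cong p q r z≈z′ = ++⁺ ≋-refl (++⁺ (replicate⁺ (suc q) z≈z′) ≋-refl)

  IsBlockOf : ∀ {m} → Carrier → Vec Carrier m → Set (c ⊔ ℓ)
  IsBlockOf x v = ∃[ z ] ((z ≈ x ⊎ z ≈ x ⁻¹) × (∃[ p ] ∃[ q ] ∃[ r ] v ≋ block z p q r))

  -- seg G y k l is, by definition, tabulate (segment-entry k l y ∘ toℕ).
  segment-entry : ℕ → ℕ → Carrier → ℕ → Carrier
  segment-entry k l y j = if ⌊ k ≤? suc j ⌋ ∧ ⌊ suc j <? l ⌋ then y else ε

  entry-before : ∀ k l y {j} → suc j < k → segment-entry k l y j ≈ ε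
  entry-before k l y {j} j<k with k ≤? suc j
  ... | yes k≤j = ⊥-elim (<⇒≱ j<k k≤j)
  ... | no _    = refl

  entry-inside : ∀ k l y {j} → k ≤ suc j → suc j < l → segment-entry k l y j ≈ y
  entry-inside k l y {j} k≤j j<l with k ≤? suc j | suc j <? l
  ... | yes _  | yes _  = refl
  ... | no k≰j | _      = ⊥-elim (k≰j k≤j)
  ... | yes _  | no j≮l = ⊥-elim (j≮l j<l)

  entry-after : ∀ k l y {j} → l ≤ suc j → segment-entry k l y j ≈ ε
  entry-after k l y {j} l≤j with k ≤? suc j | suc j <? l
  ... | _     | yes j<l = ⊥-elim (<⇒≱ j<l l≤j)
  ... | yes _ | no _    = refl
  ... | no _  | no _    = refl

  seg≋block : ∀ y p q r → seg G {p + (suc q + r)} y (suc p) (suc (p + suc q)) ≋ block y p q r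
  seg≋block y p q r = begin
    tabulate (entry ∘ toℕ)
      ≡⟨ tabulate-++ p (suc q + r) entry ⟩
    tabulate {n = p} (entry ∘ toℕ) ++ tabulate (λ i → entry (p + toℕ i))
      ≋⟨ ++⁺ (tabulate-const before) ≋-refl ⟩
    replicate p ε ++ tabulate {n = suc q + r} (λ i → entry (p + toℕ i))
      ≡⟨ ≡.cong (replicate p ε ++_) (tabulate-++ (suc q) r (entry ∘ (p +_))) ⟩
    replicate p ε ++ tabulate {n = suc q} (λ i → entry (p + toℕ i))
                  ++ tabulate {n = r} (λ i → entry (p + (suc q + toℕ i)))
      ≋⟨ ++⁺ ≋-refl (++⁺ (tabulate-const inside) (tabulate-const after)) ⟩
    block y p q r
      ∎
    where
    open ≋-Reasoning
    entry : ℕ → Carrier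
    entry = segment-entry (suc p) (suc (p + suc q)) y
    before : ∀ (i : Fin p) → entry (toℕ i) ≈ ε
    before i = entry-before (suc p) _ y (s≤s (toℕ<n i))
    inside : ∀ (i : Fin (suc q)) → entry (p + toℕ i) ≈ y
    inside i = entry-inside (suc p) _ y (s≤s (m≤m+n p (toℕ i))) (s≤s (+-monoʳ-< p (toℕ<n i)))
    after : ∀ (i : Fin r) → entry (p + (suc q + toℕ i)) ≈ ε
    after i = entry-after (suc p) _ y (s≤s (+-monoʳ-≤ p (m≤m+n (suc q) (toℕ i))))

  segment-bounds : ∀ {k l m} → 1 ≤ k → k < l → l ≤ suc m →
    ∃[ p ] ∃[ q ] ∃[ r ] (k ≡ suc p × l ≡ suc (p + suc q) × m ≡ p + (suc q + r))
  segment-bounds {suc p} {m = m} (s≤s z≤n) k<l l≤1+m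
    with q , ≡.refl ← m≤n⇒∃[o]m+o≡n k<l
    with r , l+r≡1+m ← m≤n⇒∃[o]m+o≡n l≤1+m
    = p , q , r , ≡.refl , ≡.cong suc (≡.sym (+-suc p q)) , (begin
      m                  ≡⟨ ≡.cong ℕ.pred l+r≡1+m ⟨
      suc (p + q) + r    ≡⟨ ≡.cong suc (+-assoc p q r) ⟩
      suc (p + (q + r))  ≡⟨ +-suc p (q + r) ⟨
      p + (suc q + r)    ∎)
    where open ≡.≡-Reasoning

  InI⇒IsBlockOf : ∀ {m} x (v : Vec Carrier m) → InI G x v → IsBlockOf x v
  InI⇒IsBlockOf x v (k , l , 1≤k , k<l , l≤1+m , v≋seg) with segment-bounds 1≤k k<l l≤1+m
  ... | p , q , r , ≡.refl , ≡.refl , ≡.refl = [ from x (inj₁ refl) , from (x ⁻¹) (inj₂ refl) ]′ v≋seg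
    where
    from : ∀ y → (y ≈ x ⊎ y ≈ x ⁻¹) → v ≋ seg G y (suc p) (suc (p + suc q)) → IsBlockOf x v
    from y y± v≋seg = y , y± , p , q , r , ≋-trans v≋seg (seg≋block y p q r)

  IsBlockOf⇒InI : ∀ {m} x (v : Vec Carrier m) → IsBlockOf x v → InI G x v
  IsBlockOf⇒InI x v (z , z± , p , q , r , v≋block) with Pointwise.length-equal v≋block
  ... | ≡.refl = suc p , suc (p + suc q) , s≤s z≤n , s≤s (m<m+n p (s≤s z≤n)) ,
                 s≤s (+-monoʳ-≤ p (m≤m+n (suc q) r)) , Sum.map (to x) (to (x ⁻¹)) z±
    where
    to : ∀ y → z ≈ y → v ≋ seg G y (suc p) (suc (p + suc q))
    to y z≈y = ≋-trans v≋block (≋-trans (block-cong p q r z≈y) (≋-sym (seg≋block y p q r)))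

  inverse-± : ∀ {x z} → (z ≈ x ⊎ z ≈ x ⁻¹) → (z ⁻¹ ≈ x ⊎ z ⁻¹ ≈ x ⁻¹)
  inverse-± (inj₁ z≈x)   = inj₂ (⁻¹-cong z≈x)
  inverse-± (inj₂ z≈x⁻¹) = inj₁ (trans (⁻¹-cong z≈x⁻¹) (⁻¹-involutive _))

  ω-block : ∀ {n x} (v : Vec Carrier (suc n)) → IsBlockOf x v → IsBlockOf x (ω G v)
  ω-block v (z , z± , zero , q , r , v≋block) = z ⁻¹ , inverse-± z± , q , r , 0 , (begin
    ω G v
      ≋⟨ ω-cong v≋block ⟩
    map (z ⁻¹ ∙_) (replicate q z ++ replicate r ε) ∷ʳ z ⁻¹
      ≡⟨ ≡.cong (_∷ʳ z ⁻¹) (map-++ (z ⁻¹ ∙_) (replicate q z) (replicate r ε)) ⟩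
    (map (z ⁻¹ ∙_) (replicate q z) ++ map (z ⁻¹ ∙_) (replicate r ε)) ∷ʳ z ⁻¹
      ≡⟨ ≡.cong₂ (λ u w → (u ++ w) ∷ʳ z ⁻¹) (map-replicate (z ⁻¹ ∙_) z q) (map-replicate (z ⁻¹ ∙_) ε r) ⟩
    (replicate q (z ⁻¹ ∙ z) ++ replicate r (z ⁻¹ ∙ ε)) ∷ʳ z ⁻¹
      ≋⟨ ∷ʳ⁺ (++⁺ (replicate⁺ q (inverseˡ z)) (replicate⁺ r (identityʳ (z ⁻¹)))) refl ⟩
    (replicate q ε ++ replicate r (z ⁻¹)) ∷ʳ z ⁻¹
      ≋⟨ ++-∷ʳ (replicate q ε) (replicate r (z ⁻¹)) (z ⁻¹) ⟩
    replicate q ε ++ (replicate r (z ⁻¹) ∷ʳ z ⁻¹)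
      ≡⟨ ≡.cong (replicate q ε ++_) (replicate-∷ʳ r (z ⁻¹)) ⟩
    replicate q ε ++ replicate (suc r) (z ⁻¹)
      ≋⟨ ++⁺ ≋-refl (≋-sym (++-identityʳ (replicate (suc r) (z ⁻¹)))) ⟩
    block (z ⁻¹) q r 0
      ∎)
    where open ≋-Reasoning
  ω-block v (z , z± , suc p , q , r , v≋block) = z , z± , p , q , suc r , (begin
    ω G v
      ≋⟨ ω-cong v≋block ⟩
    map (ε ⁻¹ ∙_) (block z p q r) ∷ʳ ε ⁻¹
      ≋⟨ ∷ʳ⁺ (map-id≈ ε\\x≈x (block z p q r)) ε⁻¹≈ε ⟩
    block z p q r ∷ʳ ε
      ≋⟨ ++-∷ʳ (replicate p ε) (replicate (suc q) z ++ replicate r ε) ε ⟩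
    replicate p ε ++ ((replicate (suc q) z ++ replicate r ε) ∷ʳ ε)
      ≋⟨ ++⁺ ≋-refl (++-∷ʳ (replicate (suc q) z) (replicate r ε) ε) ⟩
    replicate p ε ++ replicate (suc q) z ++ (replicate r ε ∷ʳ ε)
      ≡⟨ ≡.cong (λ t → replicate p ε ++ replicate (suc q) z ++ t) (replicate-∷ʳ r ε) ⟩
    block z p q (suc r)
      ∎)
    where open ≋-Reasoning

  τ-block : ∀ {n x} (v : Vec Carrier n) → IsBlockOf x v → IsBlockOf x (τ G v)
  τ-block v (z , z± , p , q , r , v≋block) = z , z± , r , q , p , (begin
    τ G v
      ≋⟨ reverse⁺ v≋block ⟩
    reverse (replicate p ε ++ replicate (suc q) z ++ replicate r ε)
      ≋⟨ reverse-++ (replicate p ε) (replicate (suc q) z ++ replicate r ε) ⟩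
    reverse (replicate (suc q) z ++ replicate r ε) ++ reverse (replicate p ε)
      ≋⟨ ++⁺ (reverse-++ (replicate (suc q) z) (replicate r ε)) ≋-refl ⟩
    (reverse (replicate r ε) ++ reverse (replicate (suc q) z)) ++ reverse (replicate p ε)
      ≋⟨ ++-assoc (reverse (replicate r ε)) (reverse (replicate (suc q) z)) (reverse (replicate p ε)) ⟩
    reverse (replicate r ε) ++ reverse (replicate (suc q) z) ++ reverse (replicate p ε)
      ≡⟨ ≡.cong₂ _++_ (reverse-replicate r ε)
           (≡.cong₂ _++_ (reverse-replicate (suc q) z) (reverse-replicate p ε)) ⟩
    block z r q p
      ∎)
    where open ≋-Reasoning

  act-block : ∀ {n x} w (v : Vec Carrier (suc n)) → IsBlockOf x v → IsBlockOf x (act G w v)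
  act-block []          v v-block = v-block
  act-block (true ∷ w)  v v-block = act-block w (ω G v) (ω-block v v-block)
  act-block (false ∷ w) v v-block = act-block w (τ G v) (τ-block v v-block)

  InI-act : ∀ {n} x (v : Vec Carrier (suc n)) → InI G x v → ∀ w → InI G x (act G w v)
  InI-act x v v∈I w = IsBlockOf⇒InI x _ (act-block w v (InI⇒IsBlockOf x v v∈I))

open Defs using (_≋_)
open Group using (Carrier; _≈_; ε; _⁻¹)

lemma6p9 : {c ℓ : Level} (G : Group c ℓ) (N : ℕ) → FiniteOrder G N → NonAbelian G →
  (k : ℕ) →
  ((v : Vec (Carrier G) (suc (suc k))) → _≋_ G (ω G v) v →
     ∃[ g ] (_≈_ G (pow G g (suc (suc (suc k)))) (ε G) × _≋_ G v (powers G g (suc (suc k)))))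
  × (gcd (suc (suc (suc k))) N ≡ 1 →
     (_≋_ G (ω G (𝐞 G (suc (suc k)))) (𝐞 G (suc (suc k)))
       × ((v : Vec (Carrier G) (suc (suc k))) → _≋_ G (ω G v) v → _≋_ G v (𝐞 G (suc (suc k)))))
     × (((w : List Bool) → _≋_ G (act G w (𝐞 G (suc (suc k)))) (𝐞 G (suc (suc k))))
       × ((v : Vec (Carrier G) (suc (suc k))) → ((w : List Bool) → _≋_ G (act G w v) v) →
            _≋_ G v (𝐞 G (suc (suc k))))))
  × ((x : Carrier G) → ¬ (_≈_ G x (ε G)) → (v : Vec (Carrier G) (suc (suc k))) → InI G x v →
     (w : List Bool) → InI G x (act G w v))
lemma6p9 G N finite _ k =
  ω-fixed⇒powers ,
  (λ coprime →
    (ω-𝐞 (suc k) , ω-fixed∧coprime⇒𝐞 coprime) ,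
    (ω∧τ-fixed⇒act-fixed (ω-𝐞 (suc k)) (τ-𝐞 (suc (suc k))) ,
     λ v act-fixed → ω-fixed∧coprime⇒𝐞 coprime v (act-fixed (true ∷ [])))) ,
  λ x _ → InI-act x
  where
  open Action G
  open FiniteGroup G finite
  open Segments G
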